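{- Let $G=(V,E)$ be a finite simple undirected graph, and let $G^c$ denote its complement (same vertex set, edges are the unordered pairs of distinct vertices not in $E$). Suppose $G$ satisfies: (P2) for every edge $e\in E$ there exists a unique triangle (3-cycle) $\Delta$ in $G$ with $e\in\Delta$; (P3) for every non-edge $e\in E^c$ (i.e. every edge of $G^c$) there exists a unique quadrilateral (4-cycle) $\Box$ in $G^c$ with $e\in\Box$. Then $|V|=5$ or $|V|=3$; that is, $G$ is either a triangle or two triangles intersecting in a single vertex.
   Context: A triangle is a cycle of length 3 and a quadrilateral is a cycle of length 4, each regarded as a subgraph (set of edges); uniqueness refers to these cycles as subgraphs. -}

module Defs where

open import Data.Nat using (ℕ)
open import Data.Fin using (Fin)
open import Data.Bool using (Bool; true; false)
open import Data.Product using (Σ; _×_)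
open import Data.Sum using (_⊎_)
open import Relation.Binary.PropositionalEquality using (_≡_; _≢_)

record Graph (n : ℕ) : Set where
  field
    Adj    : Fin n → Fin n → Bool
    sym    : ∀ i j → Adj i j ≡ Adj j i
    irrefl : ∀ i → Adj i i ≡ false

open Graph public

Edge : ∀ {n} → Graph n → Fin n → Fin n → Set
Edge G x y = Adj G x y ≡ true

CoEdge : ∀ {n} → Graph n → Fin n → Fin n → Set
CoEdge G x y = (x ≢ y) × (Adj G x y ≡ false)

SamePair : ∀ {n} → Fin n → Fin n → Fin n → Fin n → Set
SamePair x y u v = ((x ≡ u) × (y ≡ v)) ⊎ ((x ≡ v) × (y ≡ u))

record Triangle {n : ℕ} (R : Fin n → Fin n → Set) : Set where
  field
    a b c : Fin n
    a≢b : a ≢ b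
    b≢c : b ≢ c
    a≢c : a ≢ c
    ab : R a b
    bc : R b c
    ca : R c a

InTriangle : ∀ {n} {R : Fin n → Fin n → Set} → Triangle R → Fin n → Fin n → Set
InTriangle T x y = SamePair x y a b ⊎ SamePair x y b c ⊎ SamePair x y c a
  where open Triangle T

record Quadrilateral {n : ℕ} (R : Fin n → Fin n → Set) : Set where
  field
    a b c d : Fin n
    a≢b : a ≢ b
    a≢c : a ≢ c
    a≢d : a ≢ d
    b≢c : b ≢ c
    b≢d : b ≢ d
    c≢d : c ≢ d
    ab : R a b
    bc : R b c
    cd : R c d
    da : R d a

InQuadrilateral : ∀ {n} {R : Fin n → Fin n → Set} → Quadrilateral R → Fin n → Fin n → Set
InQuadrilateral Q x y =
  SamePair x y a b ⊎ SamePair x y b c ⊎ SamePair x y c d ⊎ SamePair x y d a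
  where open Quadrilateral Q

SameEdgeSet : ∀ {n} → (Fin n → Fin n → Set) → (Fin n → Fin n → Set) → Set
SameEdgeSet P Q = ∀ u v → (P u v → Q u v) × (Q u v → P u v)

-- there is a unique triangle (as a subgraph, i.e. edge set) containing {x , y}
UniqueTriangleThrough : ∀ {n} → (Fin n → Fin n → Set) → Fin n → Fin n → Set
UniqueTriangleThrough R x y =
  Σ (Triangle R) λ T → InTriangle T x y ×
    (∀ (T' : Triangle R) → InTriangle T' x y → SameEdgeSet (InTriangle T) (InTriangle T'))

-- there is a unique quadrilateral (as a subgraph, i.e. edge set) containing {x , y}
UniqueQuadrilateralThrough : ∀ {n} → (Fin n → Fin n → Set) → Fin n → Fin n → Set
UniqueQuadrilateralThrough R x y =
  Σ (Quadrilateral R) λ Q → InQuadrilateral Q x y ×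
    (∀ (Q' : Quadrilateral R) → InQuadrilateral Q' x y →
       SameEdgeSet (InQuadrilateral Q) (InQuadrilateral Q'))

{-# OPTIONS --safe #-}
-- Uniqueness of the triangle on each edge means two triangles share at most one vertex. G
-- contains a triangle: a complementary 4-cycle a b c d with both diagonals non-edges would make
-- a b d c a second one through ab. Let x y z be a triangle and p a further vertex. If p is
-- adjacent to, say, x, the triangle on xp meets x y z only in x. Otherwise the complementary
-- 4-cycle through px continues from x to some q, which cannot also be non-adjacent to x, y and
-- z, since then p x q y and p x q z would be two complementary 4-cycles through px. So G is a
-- triangle or contains triangles x a' a and x b' b meeting only in x. Then the cross pairs are
-- non-edges and a' b' a b is the complementary 4-cycle through a'b'. A sixth vertex t would give
-- a second one: a' b' a t if t is adjacent to neither a' nor a (or symmetrically), and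
-- otherwise, say for t adjacent to a' and b', the cycle a' b' c d, where c and d are the apexes
-- of the triangles on ta' and tb'.

module Submission where

open import Defs hiding (sym)
open import Data.Nat using (ℕ; suc; _≤_; s≤s)
open import Data.Bool using (true) renaming (_≟_ to _≟ᵇ_)
open import Data.Bool.Properties using (¬-not)
open import Data.Fin using (Fin; _≟_)
open import Data.Fin.Patterns using (0F; 1F)
open import Data.Fin.Properties using (any?; cantor-schröder-bernstein)
open import Data.Vec using (Vec; []; _∷_; lookup)
open import Data.Vec.Membership.Propositional using (_∈_)
open import Data.Vec.Relation.Unary.All as All using (All; []; _∷_)
open import Data.Vec.Relation.Unary.AllPairs using ([]; _∷_)
open import Data.Vec.Relation.Unary.Any using (here; there; index)
open import Data.Vec.Relation.Unary.Any.Properties using (lookup-index)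
open import Data.Vec.Relation.Unary.Unique.Propositional using (Unique)
open import Data.Vec.Relation.Unary.Unique.Propositional.Properties using (lookup-injective)
open import Data.Product using (∃; _×_; _,_; proj₁; proj₂; curry)
open import Data.Sum using (_⊎_; inj₁; inj₂; [_,_]′; swap)
open import Data.Empty using (⊥; ⊥-elim)
open import Function using (_∘_; id)
open import Function.Definitions using (Injective)
open import Relation.Binary using (Decidable; Symmetric)
open import Relation.Nullary using (¬_; Dec; yes; no; contradiction)
open import Relation.Nullary.Decidable using (¬?; toSum)
open import Relation.Binary.PropositionalEquality
  using (_≡_; _≢_; refl; sym; trans; cong; ≢-sym; module ≡-Reasoning)

enumeration-length : ∀ {n k} {xs : Vec (Fin n) k} →
                     Unique xs → (∀ t → ¬ All (t ≢_) xs) → n ≡ k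
enumeration-length {n} {k} {xs} distinct avoids =
  cantor-schröder-bernstein position-injective (λ {i} {j} → lookup-injective distinct i j)
  where
  cover : ∀ t → t ∈ xs
  cover t = [ ⊥-elim ∘ avoids t , id ]′ (All.decide (λ y → swap (toSum (t ≟ y))) xs)

  position : Fin n → Fin k
  position t = index (cover t)

  position-injective : Injective _≡_ _≡_ position
  position-injective {t} {t'} eq = begin
    t                       ≡⟨ lookup-index (cover t) ⟩
    lookup xs (position t)  ≡⟨ cong (lookup xs) eq ⟩
    lookup xs (position t') ≡⟨ sym (lookup-index (cover t')) ⟩
    t'                      ∎
    where open ≡-Reasoning

module _ {n : ℕ} {R : Fin n → Fin n → Set} (R-sym : Symmetric R) (T : Triangle R) where
  open Triangle T

  third-corner : ∀ {u v} → InTriangle T u v → ∃ λ w → R v w × R w u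
  third-corner (inj₁ (inj₁ (refl , refl)))        = c , bc , ca
  third-corner (inj₁ (inj₂ (refl , refl)))        = c , R-sym ca , R-sym bc
  third-corner (inj₂ (inj₁ (inj₁ (refl , refl)))) = a , ca , ab
  third-corner (inj₂ (inj₁ (inj₂ (refl , refl)))) = a , R-sym ab , R-sym ca
  third-corner (inj₂ (inj₂ (inj₁ (refl , refl)))) = b , ab , bc
  third-corner (inj₂ (inj₂ (inj₂ (refl , refl)))) = b , R-sym bc , R-sym ab

module _ {n : ℕ} {R : Fin n → Fin n → Set} (Q : Quadrilateral R) where
  open Quadrilateral Q

  corners : Vec (Fin n) 4
  corners = a ∷ b ∷ c ∷ d ∷ []

  ab∈Q : InQuadrilateral Q a b
  ab∈Q = inj₁ (inj₁ (refl , refl))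

  InQuadrilateral⇒∈corners : ∀ {s t} → InQuadrilateral Q s t → s ∈ corners
  InQuadrilateral⇒∈corners (inj₁ (inj₁ (s≡a , _)))               = here s≡a
  InQuadrilateral⇒∈corners (inj₁ (inj₂ (s≡b , _)))               = there (here s≡b)
  InQuadrilateral⇒∈corners (inj₂ (inj₁ (inj₁ (s≡b , _))))        = there (here s≡b)
  InQuadrilateral⇒∈corners (inj₂ (inj₁ (inj₂ (s≡c , _))))        = there (there (here s≡c))
  InQuadrilateral⇒∈corners (inj₂ (inj₂ (inj₁ (inj₁ (s≡c , _))))) = there (there (here s≡c))
  InQuadrilateral⇒∈corners (inj₂ (inj₂ (inj₁ (inj₂ (s≡d , _))))) = there (there (there (here s≡d)))
  InQuadrilateral⇒∈corners (inj₂ (inj₂ (inj₂ (inj₁ (s≡d , _))))) = there (there (there (here s≡d)))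
  InQuadrilateral⇒∈corners (inj₂ (inj₂ (inj₂ (inj₂ (s≡a , _))))) = here s≡a

  ∈corners⇒InQuadrilateral : ∀ {s} → s ∈ corners → ∃ λ t → InQuadrilateral Q s t
  ∈corners⇒InQuadrilateral (here refl)                         = b , inj₁ (inj₁ (refl , refl))
  ∈corners⇒InQuadrilateral (there (here refl))                 = c , inj₂ (inj₁ (inj₁ (refl , refl)))
  ∈corners⇒InQuadrilateral (there (there (here refl)))         = d , inj₂ (inj₂ (inj₁ (inj₁ (refl , refl))))
  ∈corners⇒InQuadrilateral (there (there (there (here refl)))) = a , inj₂ (inj₂ (inj₂ (inj₁ (refl , refl))))

  ¬InQuadrilateral-diagonal : ¬ InQuadrilateral Q b d
  ¬InQuadrilateral-diagonal (inj₁ (inj₁ (b≡a , _)))               = a≢b (sym b≡a)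
  ¬InQuadrilateral-diagonal (inj₁ (inj₂ (_ , d≡a)))               = a≢d (sym d≡a)
  ¬InQuadrilateral-diagonal (inj₂ (inj₁ (inj₁ (_ , d≡c))))        = c≢d (sym d≡c)
  ¬InQuadrilateral-diagonal (inj₂ (inj₁ (inj₂ (b≡c , _))))        = b≢c b≡c
  ¬InQuadrilateral-diagonal (inj₂ (inj₂ (inj₁ (inj₁ (b≡c , _))))) = b≢c b≡c
  ¬InQuadrilateral-diagonal (inj₂ (inj₂ (inj₁ (inj₂ (b≡d , _))))) = b≢d b≡d
  ¬InQuadrilateral-diagonal (inj₂ (inj₂ (inj₂ (inj₁ (b≡d , _))))) = b≢d b≡d
  ¬InQuadrilateral-diagonal (inj₂ (inj₂ (inj₂ (inj₂ (b≡a , _))))) = a≢b (sym b≡a)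

  next-corner : Symmetric R → ∀ {u v} → InQuadrilateral Q u v → ∃ λ w → R v w × w ≢ u
  next-corner R-sym (inj₁ (inj₁ (refl , refl)))               = c , bc , ≢-sym a≢c
  next-corner R-sym (inj₁ (inj₂ (refl , refl)))               = d , R-sym da , ≢-sym b≢d
  next-corner R-sym (inj₂ (inj₁ (inj₁ (refl , refl))))        = d , cd , ≢-sym b≢d
  next-corner R-sym (inj₂ (inj₁ (inj₂ (refl , refl))))        = a , R-sym ab , a≢c
  next-corner R-sym (inj₂ (inj₂ (inj₁ (inj₁ (refl , refl))))) = a , da , a≢c
  next-corner R-sym (inj₂ (inj₂ (inj₁ (inj₂ (refl , refl))))) = b , R-sym bc , b≢d
  next-corner R-sym (inj₂ (inj₂ (inj₂ (inj₁ (refl , refl))))) = b , ab , b≢d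
  next-corner R-sym (inj₂ (inj₂ (inj₂ (inj₂ (refl , refl))))) = c , R-sym cd , ≢-sym a≢c

module _ {n : ℕ} (G : Graph n) where

  Edge-sym : ∀ {x y} → Edge G x y → Edge G y x
  Edge-sym {x} {y} xy = trans (Graph.sym G y x) xy

  Edge⇒≢ : ∀ {x y} → Edge G x y → x ≢ y
  Edge⇒≢ {x} xx refl = contradiction (trans (sym xx) (irrefl G x)) λ ()

  CoEdge-sym : ∀ {x y} → CoEdge G x y → CoEdge G y x
  CoEdge-sym {x} {y} (x≢y , xy) = ≢-sym x≢y , trans (Graph.sym G y x) xy

  CoEdge⇒≢ : ∀ {x y} → CoEdge G x y → x ≢ y
  CoEdge⇒≢ = proj₁

  CoEdge⇒¬Edge : ∀ {x y} → CoEdge G x y → ¬ Edge G x y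
  CoEdge⇒¬Edge (_ , xy) xy′ = contradiction (trans (sym xy′) xy) λ ()

  ¬Edge⇒CoEdge : ∀ {x y} → x ≢ y → ¬ Edge G x y → CoEdge G x y
  ¬Edge⇒CoEdge x≢y ¬xy = x≢y , ¬-not ¬xy

  Edge? : Decidable (Edge G)
  Edge? x y = Adj G x y ≟ᵇ true

  IsTriangle : Fin n → Fin n → Fin n → Set
  IsTriangle x y z = Edge G x y × Edge G y z × Edge G z x

  module _ {x y z : Fin n} where

    rotate : IsTriangle x y z → IsTriangle y z x
    rotate (xy , yz , zx) = yz , zx , xy

    reflect : IsTriangle x y z → IsTriangle x z y
    reflect (xy , yz , zx) = Edge-sym zx , Edge-sym yz , Edge-sym xy

    toTriangle : IsTriangle x y z → Triangle (Edge G)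
    toTriangle (xy , yz , zx) = record
      { a = x ; b = y ; c = z
      ; a≢b = Edge⇒≢ xy ; b≢c = Edge⇒≢ yz ; a≢c = ≢-sym (Edge⇒≢ zx)
      ; ab = xy ; bc = yz ; ca = zx
      }

    triangle-spans⇒order-3 : IsTriangle x y z → (∀ t → ¬ All (t ≢_) (x ∷ y ∷ z ∷ [])) → n ≡ 3
    triangle-spans⇒order-3 (xy , yz , zx) = enumeration-length distinct
      where
      distinct : Unique (x ∷ y ∷ z ∷ [])
      distinct = (Edge⇒≢ xy ∷ ≢-sym (Edge⇒≢ zx) ∷ []) ∷ (Edge⇒≢ yz ∷ []) ∷ [] ∷ []

  coQuadrilateral : ∀ {a b c d} → a ≢ c → b ≢ d →
                    CoEdge G a b → CoEdge G b c → CoEdge G c d → CoEdge G d a →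
                    Quadrilateral (CoEdge G)
  coQuadrilateral {a} {b} {c} {d} a≢c b≢d ab bc cd da = record
    { a = a ; b = b ; c = c ; d = d
    ; a≢b = CoEdge⇒≢ ab ; a≢c = a≢c ; a≢d = ≢-sym (CoEdge⇒≢ da)
    ; b≢c = CoEdge⇒≢ bc ; b≢d = b≢d ; c≢d = CoEdge⇒≢ cd
    ; ab = ab ; bc = bc ; cd = cd ; da = da
    }

  EdgesInUniqueTriangles : Set
  EdgesInUniqueTriangles = ∀ x y → Edge G x y → UniqueTriangleThrough (Edge G) x y

  NonEdgesInUniqueQuadrilaterals : Set
  NonEdgesInUniqueQuadrilaterals =
    ∀ x y → CoEdge G x y → UniqueQuadrilateralThrough (CoEdge G) x y

  module TriangleUniqueness (unique△ : EdgesInUniqueTriangles) where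

    apex : ∀ {x y} → Edge G x y → ∃ λ z → IsTriangle x y z
    apex xy with unique△ _ _ xy
    ... | T , xy∈T , _ with third-corner Edge-sym T xy∈T
    ...   | z , yz , zx = z , xy , yz , zx

    apex-unique : ∀ {x u w w'} → IsTriangle x u w → IsTriangle x u w' → w ≡ w'
    apex-unique {x} {u} {w} {w'} xuw@(xu , uw , wx) xuw' with unique△ x u xu
    ... | _ , _ , same = wx∈xuw'⇒ (proj₁ (same (toTriangle xuw') (xu∈T xuw') w x)
                                          (proj₂ (same (toTriangle xuw) (xu∈T xuw) w x) wx∈xuw))
      where
      xu∈T : ∀ {v} (xuv : IsTriangle x u v) → InTriangle (toTriangle xuv) x u
      xu∈T _ = inj₁ (inj₁ (refl , refl))

      wx∈xuw : InTriangle (toTriangle xuw) w x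
      wx∈xuw = inj₂ (inj₂ (inj₁ (refl , refl)))

      wx∈xuw'⇒ : InTriangle (toTriangle xuw') w x → w ≡ w'
      wx∈xuw'⇒ (inj₁ (inj₁ (w≡x , _)))         = contradiction w≡x (Edge⇒≢ wx)
      wx∈xuw'⇒ (inj₁ (inj₂ (w≡u , _)))         = contradiction (sym w≡u) (Edge⇒≢ uw)
      wx∈xuw'⇒ (inj₂ (inj₁ (inj₁ (w≡u , _))))  = contradiction (sym w≡u) (Edge⇒≢ uw)
      wx∈xuw'⇒ (inj₂ (inj₁ (inj₂ (w≡w' , _)))) = w≡w'
      wx∈xuw'⇒ (inj₂ (inj₂ (inj₁ (w≡w' , _)))) = w≡w'
      wx∈xuw'⇒ (inj₂ (inj₂ (inj₂ (w≡x , _))))  = contradiction w≡x (Edge⇒≢ wx)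

    non-edge-across : ∀ {x u u' v} → IsTriangle x u u' → Edge G x v → v ≢ u → v ≢ u' →
                      CoEdge G u v
    non-edge-across xuu'@(xu , _) xv v≢u v≢u' =
      ¬Edge⇒CoEdge (≢-sym v≢u) λ uv → v≢u' (apex-unique (xu , uv , Edge-sym xv) xuu')

  module QuadrilateralUniqueness (unique□ : NonEdgesInUniqueQuadrilaterals) where

    quadrilateral-unique : ∀ {u v s t} → CoEdge G u v → (Q Q' : Quadrilateral (CoEdge G)) →
                           InQuadrilateral Q u v → InQuadrilateral Q' u v →
                           InQuadrilateral Q' s t → InQuadrilateral Q s t
    quadrilateral-unique {u} {v} {s} {t} uv Q Q' uv∈Q uv∈Q' with unique□ u v uv
    ... | _ , _ , same = proj₁ (same Q uv∈Q s t) ∘ proj₂ (same Q' uv∈Q' s t)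

    corners-unique : ∀ {u v s} → CoEdge G u v → (Q Q' : Quadrilateral (CoEdge G)) →
                     InQuadrilateral Q u v → InQuadrilateral Q' u v →
                     s ∈ corners Q' → s ∈ corners Q
    corners-unique uv Q Q' uv∈Q uv∈Q' s∈Q' with ∈corners⇒InQuadrilateral Q' s∈Q'
    ... | _ , st∈Q' = InQuadrilateral⇒∈corners Q (quadrilateral-unique uv Q Q' uv∈Q uv∈Q' st∈Q')

    next-co-neighbour : ∀ {u v} → CoEdge G u v → ∃ λ w → CoEdge G v w × w ≢ u
    next-co-neighbour uv with unique□ _ _ uv
    ... | Q , uv∈Q , _ = next-corner Q CoEdge-sym uv∈Q

    diagonal-edge : (Q : Quadrilateral (CoEdge G)) →
                    let open Quadrilateral Q in Edge G a c ⊎ Edge G b d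
    diagonal-edge Q = decide (Edge? a c) (Edge? b d)
      where
      open Quadrilateral Q
      decide : Dec (Edge G a c) → Dec (Edge G b d) → Edge G a c ⊎ Edge G b d
      decide (yes ac) _        = inj₁ ac
      decide (no _)   (yes bd) = inj₂ bd
      decide (no ¬ac) (no ¬bd) = ⊥-elim (¬InQuadrilateral-diagonal Q
        (quadrilateral-unique ab Q abdc (ab∈Q Q) (ab∈Q abdc) (inj₂ (inj₁ (inj₁ (refl , refl))))))
        where
        abdc : Quadrilateral (CoEdge G)
        abdc = coQuadrilateral a≢d b≢c ab (¬Edge⇒CoEdge b≢d ¬bd) (CoEdge-sym cd)
                               (CoEdge-sym (¬Edge⇒CoEdge a≢c ¬ac))

    edge-exists : ∀ {u v} → u ≢ v → ∃ λ x → ∃ λ y → Edge G x y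
    edge-exists {u} {v} u≢v with Edge? u v
    ... | yes uv = u , v , uv
    ... | no ¬uv with diagonal-edge (proj₁ (unique□ u v (¬Edge⇒CoEdge u≢v ¬uv)))
    ...   | inj₁ ac = _ , _ , ac
    ...   | inj₂ bd = _ , _ , bd

    ¬two-non-neighbours : ∀ {x y z p q} → IsTriangle x y z →
                          All (CoEdge G p) (x ∷ y ∷ z ∷ []) → All (CoEdge G q) (x ∷ y ∷ z ∷ []) →
                          p ≢ q → ⊥
    ¬two-non-neighbours (xy , yz , zx) (px ∷ py ∷ pz ∷ []) (qx ∷ qy ∷ qz ∷ []) p≢q =
      All.lookup z-off (corners-unique px pxqy pxqz (ab∈Q pxqy) (ab∈Q pxqz)
                          (there (there (there (here refl))))) refl
      where
      pxqy pxqz : Quadrilateral (CoEdge G)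
      pxqy = coQuadrilateral p≢q (Edge⇒≢ xy) px (CoEdge-sym qx) qy (CoEdge-sym py)
      pxqz = coQuadrilateral p≢q (≢-sym (Edge⇒≢ zx)) px (CoEdge-sym qx) qz (CoEdge-sym pz)
      z-off : All (_ ≢_) (corners pxqy)
      z-off = ≢-sym (CoEdge⇒≢ pz) ∷ Edge⇒≢ zx ∷ ≢-sym (CoEdge⇒≢ qz) ∷ ≢-sym (Edge⇒≢ yz) ∷ []

  record Bowtie (x a' a b' b : Fin n) : Set where
    field
      left  : IsTriangle x a' a
      right : IsTriangle x b' b
      a'≢b' : a' ≢ b'
      a'≢b  : a' ≢ b
      a≢b'  : a ≢ b'
      a≢b   : a ≢ b

  module _ {x a' a b' b : Fin n} (B : Bowtie x a' a b' b) where
    open Bowtie B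

    flipˡ : Bowtie x a a' b' b
    flipˡ = record { left = reflect left ; right = right
                   ; a'≢b' = a≢b' ; a'≢b = a≢b ; a≢b' = a'≢b' ; a≢b = a'≢b }

    flipʳ : Bowtie x a' a b b'
    flipʳ = record { left = left ; right = reflect right
                   ; a'≢b' = a'≢b ; a'≢b = a'≢b' ; a≢b' = a≢b ; a≢b = a≢b' }

    swap-sides : Bowtie x b' b a' a
    swap-sides = record { left = right ; right = left
                        ; a'≢b' = ≢-sym a'≢b' ; a'≢b = ≢-sym a≢b'
                        ; a≢b' = ≢-sym a'≢b ; a≢b = ≢-sym a≢b }

  module Classification (unique△ : EdgesInUniqueTriangles)
                        (unique□ : NonEdgesInUniqueQuadrilaterals) where
    open TriangleUniqueness unique△
    open QuadrilateralUniqueness unique□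

    cross-non-edge : ∀ {x a' a b' b} → Bowtie x a' a b' b → CoEdge G a' b'
    cross-non-edge B = non-edge-across left (proj₁ right) (≢-sym a'≢b') (≢-sym a≢b')
      where open Bowtie B

    complement-cycle : ∀ {x a' a b' b} → Bowtie x a' a b' b → Quadrilateral (CoEdge G)
    complement-cycle {a' = a'} {a} {b'} {b} B =
      coQuadrilateral {a'} {b'} {a} {b} (Edge⇒≢ (proj₁ (proj₂ left))) (Edge⇒≢ (proj₁ (proj₂ right)))
        (cross-non-edge B) (CoEdge-sym (cross-non-edge (flipˡ B)))
        (cross-non-edge (flipˡ (flipʳ B))) (CoEdge-sym (cross-non-edge (flipʳ B)))
      where open Bowtie B

    ¬misses-side : ∀ {x a' a b' b t} (B : Bowtie x a' a b' b) →
                   All (t ≢_) (a' ∷ b' ∷ a ∷ b ∷ []) → ¬ Edge G t a' → ¬ Edge G t a → ⊥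
    ¬misses-side B t-off@(t≢a' ∷ t≢b' ∷ t≢a ∷ _) ¬ta' ¬ta =
      All.lookup t-off (corners-unique (cross-non-edge B) (complement-cycle B) a'b'at
                          (ab∈Q (complement-cycle B)) (ab∈Q a'b'at)
                          (there (there (there (here refl))))) refl
      where
      open Bowtie B
      a'b'at : Quadrilateral (CoEdge G)
      a'b'at = coQuadrilateral (Edge⇒≢ (proj₁ (proj₂ left))) (≢-sym t≢b')
                 (cross-non-edge B) (CoEdge-sym (cross-non-edge (flipˡ B)))
                 (CoEdge-sym (¬Edge⇒CoEdge t≢a ¬ta)) (¬Edge⇒CoEdge t≢a' ¬ta')

    ¬common-neighbour : ∀ {x a' a b' b t} (B : Bowtie x a' a b' b) → t ≢ x →
                        Edge G t a' → Edge G t b' → ⊥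
    ¬common-neighbour {a' = a'} {a} {b'} {b} B t≢x ta' tb' with apex ta' | apex tb'
    ... | c , ta'c@(_ , a'c , ct) | d , tb'd@(_ , b'd , dt) =
      All.lookup c-off (corners-unique (cross-non-edge B) (complement-cycle B) a'b'cd
                          (ab∈Q (complement-cycle B)) (ab∈Q a'b'cd)
                          (there (there (here refl)))) refl
      where
      open Bowtie B
      c≢d : c ≢ d
      c≢d refl = a'≢b' (apex-unique (reflect ta'c) (reflect tb'd))
      b'≢c : b' ≢ c
      b'≢c refl = CoEdge⇒¬Edge (cross-non-edge B) a'c
      a'≢d : a' ≢ d
      a'≢d refl = CoEdge⇒¬Edge (cross-non-edge B) (Edge-sym b'd)
      a'b'cd : Quadrilateral (CoEdge G)
      a'b'cd = coQuadrilateral (Edge⇒≢ a'c) (Edge⇒≢ b'd) (cross-non-edge B)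
        (¬Edge⇒CoEdge b'≢c λ b'c → c≢d (apex-unique (tb' , b'c , ct) tb'd))
        (¬Edge⇒CoEdge c≢d λ cd → a'≢d (sym (apex-unique (Edge-sym ct , cd , dt) (reflect ta'c))))
        (¬Edge⇒CoEdge (≢-sym a'≢d) λ da' → c≢d (sym (apex-unique (ta' , Edge-sym da' , dt) ta'c)))
      c≢a : c ≢ a
      c≢a refl = t≢x (apex-unique (a'c , ct , ta') (rotate left))
      c≢b : c ≢ b
      c≢b refl = CoEdge⇒¬Edge (cross-non-edge (flipʳ B)) a'c
      c-off : All (c ≢_) (a' ∷ b' ∷ a ∷ b ∷ [])
      c-off = ≢-sym (Edge⇒≢ a'c) ∷ ≢-sym b'≢c ∷ c≢a ∷ c≢b ∷ []

    bowtie-spans : ∀ {x a' a b' b t} → Bowtie x a' a b' b →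
                   ¬ All (t ≢_) (x ∷ a' ∷ a ∷ b' ∷ b ∷ [])
    bowtie-spans {a' = a'} {a} {b'} {b} {t} B (t≢x ∷ t≢a' ∷ t≢a ∷ t≢b' ∷ t≢b ∷ [])
      with Edge? t a' | Edge? t a | Edge? t b' | Edge? t b
    ... | no ¬ta' | no ¬ta | _ | _ = ¬misses-side B (t≢a' ∷ t≢b' ∷ t≢a ∷ t≢b ∷ []) ¬ta' ¬ta
    ... | _ | _ | no ¬tb' | no ¬tb =
      ¬misses-side (swap-sides B) (t≢b' ∷ t≢a' ∷ t≢b ∷ t≢a ∷ []) ¬tb' ¬tb
    ... | yes ta' | _ | yes tb' | _ = ¬common-neighbour B t≢x ta' tb'
    ... | yes ta' | _ | _ | yes tb  = ¬common-neighbour (flipʳ B) t≢x ta' tb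
    ... | _ | yes ta | yes tb' | _  = ¬common-neighbour (flipˡ B) t≢x ta tb'
    ... | _ | yes ta | _ | yes tb   = ¬common-neighbour (flipˡ (flipʳ B)) t≢x ta tb

    bowtie⇒order-5 : ∀ {x a' a b' b} → Bowtie x a' a b' b → n ≡ 5
    bowtie⇒order-5 {x} {a'} {a} {b'} {b} B = enumeration-length distinct (λ _ → bowtie-spans B)
      where
      open Bowtie B
      distinct : Unique (x ∷ a' ∷ a ∷ b' ∷ b ∷ [])
      distinct = (Edge⇒≢ (proj₁ left) ∷ ≢-sym (Edge⇒≢ (proj₂ (proj₂ left)))
                   ∷ Edge⇒≢ (proj₁ right) ∷ ≢-sym (Edge⇒≢ (proj₂ (proj₂ right))) ∷ [])
               ∷ (Edge⇒≢ (proj₁ (proj₂ left)) ∷ a'≢b' ∷ a'≢b ∷ [])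
               ∷ (a≢b' ∷ a≢b ∷ [])
               ∷ (Edge⇒≢ (proj₁ (proj₂ right)) ∷ [])
               ∷ [] ∷ []

    neighbour⇒order-5 : ∀ {x y z p} → IsTriangle x y z → All (p ≢_) (x ∷ y ∷ z ∷ []) →
                        Edge G x p → n ≡ 5
    neighbour⇒order-5 {y = y} {z} xyz@(xy , _ , zx) (_ ∷ p≢y ∷ p≢z ∷ []) xp with apex xp
    ... | q , xpq@(_ , pq , _) = bowtie⇒order-5 (record
      { left = xyz ; right = xpq
      ; a'≢b' = ≢-sym p≢y ; a'≢b = y≢q ; a≢b' = ≢-sym p≢z ; a≢b = z≢q })
      where
      y≢q : y ≢ q
      y≢q refl = p≢z (sym (apex-unique xyz (xy , Edge-sym pq , Edge-sym xp)))
      z≢q : z ≢ q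
      z≢q refl = p≢y (sym (apex-unique (reflect xyz) (Edge-sym zx , Edge-sym pq , Edge-sym xp)))

    neighbour-or-non-neighbour : ∀ {x y z p} → IsTriangle x y z → All (p ≢_) (x ∷ y ∷ z ∷ []) →
                                 n ≡ 5 ⊎ All (CoEdge G p) (x ∷ y ∷ z ∷ [])
    neighbour-or-non-neighbour {x} {y} {z} {p} xyz p-off@(p≢x ∷ p≢y ∷ p≢z ∷ [])
      with Edge? p x | Edge? p y | Edge? p z
    ... | yes px | _ | _ =
      inj₁ (neighbour⇒order-5 xyz p-off (Edge-sym px))
    ... | _ | yes py | _ =
      inj₁ (neighbour⇒order-5 (rotate xyz) (p≢y ∷ p≢z ∷ p≢x ∷ []) (Edge-sym py))
    ... | _ | _ | yes pz =
      inj₁ (neighbour⇒order-5 (rotate (rotate xyz)) (p≢z ∷ p≢x ∷ p≢y ∷ []) (Edge-sym pz))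
    ... | no ¬px | no ¬py | no ¬pz =
      inj₂ (¬Edge⇒CoEdge p≢x ¬px ∷ ¬Edge⇒CoEdge p≢y ¬py ∷ ¬Edge⇒CoEdge p≢z ¬pz ∷ [])

    non-neighbour-off-triangle : ∀ {x y z q} → IsTriangle x y z → CoEdge G x q →
                                 All (q ≢_) (x ∷ y ∷ z ∷ [])
    non-neighbour-off-triangle (xy , _ , zx) xq =
      ≢-sym (CoEdge⇒≢ xq)
        ∷ (λ { refl → CoEdge⇒¬Edge xq xy })
        ∷ (λ { refl → CoEdge⇒¬Edge xq (Edge-sym zx) })
        ∷ []

    outside-vertex⇒order-5 : ∀ {x y z p} → IsTriangle x y z → All (p ≢_) (x ∷ y ∷ z ∷ []) → n ≡ 5
    outside-vertex⇒order-5 xyz p-off with neighbour-or-non-neighbour xyz p-off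
    ... | inj₁ n≡5 = n≡5
    ... | inj₂ p-non-adjacent@(px ∷ _) with next-co-neighbour px
    ...   | q , xq , q≢p with neighbour-or-non-neighbour xyz (non-neighbour-off-triangle xyz xq)
    ...     | inj₁ n≡5 = n≡5
    ...     | inj₂ q-non-adjacent =
      ⊥-elim (¬two-non-neighbours xyz p-non-adjacent q-non-adjacent (≢-sym q≢p))

    order-3-or-5 : ∀ {u v} → u ≢ v → n ≡ 3 ⊎ n ≡ 5
    order-3-or-5 u≢v
      with x , y , xy ← edge-exists u≢v
      with z , xyz ← apex xy
      with any? (λ p → All.all? (λ v → ¬? (p ≟ v)) (x ∷ y ∷ z ∷ []))
    ... | yes (_ , p-off) = inj₂ (outside-vertex⇒order-5 xyz p-off)
    ... | no ¬p-off = inj₁ (triangle-spans⇒order-3 xyz (curry ¬p-off))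

theorem1 : (n : ℕ) (G : Graph n) → 2 ≤ n →
    (∀ x y → Edge G x y → UniqueTriangleThrough (Edge G) x y) →
    (∀ x y → CoEdge G x y → UniqueQuadrilateralThrough (CoEdge G) x y) →
    (n ≡ 3) ⊎ (n ≡ 5)
theorem1 (suc (suc _)) G (s≤s (s≤s _)) unique△ unique□ = order-3-or-5 {0F} {1F} λ ()
  where open Classification G unique△ unique□
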